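{- If a Boolean algebra $B$ has an $M$-ideal, then $B$ has a graded $\sigma$-bounded cc fragmentation.
   Context: A Boolean algebra here is an algebra $B$ of subsets of a nonempty set $S$ with operations $\cup,\cap$, complement, $\mathbf 0=\emptyset$, $\mathbf 1=S$, and $a\le b$ iff $a\subseteq b$; $B^+=B\setminus\{\mathbf 0\}$. An antichain is a set of pairwise disjoint elements of $B^+$. Sequences are indexed by positive integers. A set $I$ of infinite sequences in $B^+$ is an $M$-ideal if: (M1) if $\{a_n\}_n\in I$ then there is no $a>\mathbf 0$ with $a\le a_n$ for all $n$; (M2) if $s\in I$ and $t$ is an infinite subsequence of $s$ then $t\in I$; (M3) if $\{a_n\}_n\in I$ and $b_n\in B^+$ with $b_n\le a_n$ for all $n$ then $\{b_n\}_n\in I$; (M4) if $\{a_n\}_n,\{b_n\}_n\in I$ then $\{a_n\cup b_n\}_n$ has an infinite subsequence in $I$; (M5) if $\{a^k_n\}_n\in I$ for every $k$, then $\{a^n_n\}_n\in I$; (M6) if for every $n$, $A_n$ is a finite antichain with $|A_n|\ge n$, then there exist $a_n\in A_n$ with $\{a_n\}_n\in I$. A fragmentation of $B$ is a sequence of subsets $C_1\subseteq C_2\subseteq\cdots$ with $\bigcup_n C_n=B^+$ such that for every $n$, if $a\in C_n$ and $a\le b$ then $b\in C_n$. It is $\sigma$-bounded cc if for every $n$ there is a constant $K_n$ such that every antichain $A\subseteq C_n$ has size at most $K_n$. It is graded if for every $n$, whenever $a\cup b\in C_n$ then $a\in C_{n+1}$ or $b\in C_{n+1}$. -}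

module Defs where

open import Level using (Level; _⊔_) renaming (suc to lsuc)
open import Algebra.Lattice.Bundles using (BooleanAlgebra)
open import Data.Nat using (ℕ; suc; _≤_; _<_)
open import Data.Fin using (Fin)
open import Data.Product using (Σ; ∃; _×_; _,_)
open import Data.Sum using (_⊎_)
open import Relation.Nullary using (¬_)
open import Relation.Binary.PropositionalEquality using (_≡_)
open import Relation.Unary using (Pred; _∈_; _⊆_)

-- Sequences are indexed by ℕ = {0,1,2,...}; index n here corresponds to
-- index n+1 of the paper (positive integers).

module _ {c ℓ : Level} (B : BooleanAlgebra c ℓ) where
  open BooleanAlgebra B renaming (¬_ to ∁_)

  _≤B_ : Carrier → Carrier → Set ℓ
  a ≤B b = (a ∧ b) ≈ a

  Pos : Carrier → Set ℓ
  Pos a = ¬ (a ≈ ⊥)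

  Disjoint : Carrier → Carrier → Set ℓ
  Disjoint a b = (a ∧ b) ≈ ⊥

  -- a finite antichain of size m, given by an enumeration A : Fin m → B:
  -- all elements are in B⁺ and distinct positions are pairwise disjoint
  -- (hence the m elements are distinct, so the antichain has exactly m elements)
  FinAntichain : {m : ℕ} → (Fin m → Carrier) → Set ℓ
  FinAntichain {m} A =
    (∀ i → Pos (A i)) × (∀ i j → ¬ (i ≡ j) → Disjoint (A i) (A j))

  Seq : Set c
  Seq = ℕ → Carrier

  StrictlyIncreasing : (ℕ → ℕ) → Set
  StrictlyIncreasing σ = ∀ n → σ n < σ (suc n)

  record IsMIdeal {i : Level} (I : Pred Seq i) : Set (c ⊔ ℓ ⊔ i) where
    field
      -- I is a set of sequences in B⁺
      M0 : ∀ {s} → s ∈ I → ∀ n → Pos (s n)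
      M1 : ∀ {s} → s ∈ I → ¬ (Σ Carrier λ a → Pos a × (∀ n → a ≤B s n))
      M2 : ∀ {s} → s ∈ I → (σ : ℕ → ℕ) → StrictlyIncreasing σ →
           (λ n → s (σ n)) ∈ I
      M3 : ∀ {s t} → s ∈ I → (∀ n → Pos (t n)) → (∀ n → t n ≤B s n) → t ∈ I
      M4 : ∀ {s t} → s ∈ I → t ∈ I →
           Σ (ℕ → ℕ) λ σ → StrictlyIncreasing σ × ((λ n → s (σ n) ∨ t (σ n)) ∈ I)
      M5 : (a : ℕ → Seq) → (∀ k → a k ∈ I) → (λ n → a n n) ∈ I
      -- (paper index n+1 ↦ here n): |A_n| ≥ n+1
      M6 : (m : ℕ → ℕ) (A : (n : ℕ) → Fin (m n) → Carrier) →
           (∀ n → suc n ≤ m n) → (∀ n → FinAntichain (A n)) →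
           Σ ((n : ℕ) → Fin (m n)) λ f → (λ n → A n (f n)) ∈ I

  HasMIdeal : (i : Level) → Set (c ⊔ ℓ ⊔ lsuc i)
  HasMIdeal i = Σ (Pred Seq i) IsMIdeal

  record IsFragmentation {j : Level} (C : ℕ → Pred Carrier j) : Set (c ⊔ ℓ ⊔ j) where
    field
      increasing : ∀ n → C n ⊆ C (suc n)
      union⊆     : ∀ n {a} → a ∈ C n → Pos a
      ⊆union     : ∀ {a} → Pos a → Σ ℕ λ n → a ∈ C n
      upward     : ∀ n {a b} → a ∈ C n → a ≤B b → b ∈ C n

  SigmaBoundedCC : {j : Level} → (ℕ → Pred Carrier j) → Set (c ⊔ ℓ ⊔ j)
  SigmaBoundedCC C =
    Σ (ℕ → ℕ) λ K → ∀ n {m} (A : Fin m → Carrier) → FinAntichain A →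
      (∀ k → A k ∈ C n) → m ≤ K n

  Graded : {j : Level} → (ℕ → Pred Carrier j) → Set (c ⊔ j)
  Graded C = ∀ n a b → (a ∨ b) ∈ C n → a ∈ C (suc n) ⊎ b ∈ C (suc n)

  HasGradedσBoundedCCFragmentation : (j : Level) → Set (c ⊔ ℓ ⊔ lsuc j)
  HasGradedσBoundedCCFragmentation j =
    Σ (ℕ → Pred Carrier j) λ C → IsFragmentation C × SigmaBoundedCC C × Graded C

module Submission where

-- Fix an M-ideal I and call x "k-small" if x > 0 and x ≤ s k for some s ∈ I;
-- call x "k-large" if x > 0 and x is not k-small.  Using the axioms of I:
--   * k-smallness decreases in k (M2), so k-largeness increases in k;
--   * if xₖ is k-small for every k then (xₖ)ₖ ∈ I (M5, M3), hence by M1 no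
--     positive element is k-small for every k: every x > 0 is eventually large;
--   * antichains of k-large elements have bounded size, since otherwise M6
--     picks a sequence in I whose k-th term is both k-large and k-small;
--   * for every q there is p such that the join of two p-small elements is
--     q-small, since otherwise M5 and M4 produce a sequence in I of joins
--     whose q-th term is not q-small.
-- Choose levels with level (n+1) ≥ level n and level (n+1) at least the p
-- that the last point gives for q = level n; then the sets Cₙ of
-- (level n)-large elements form the fragmentation, graded by the last point.

open import Defs
open import Level using (Level; _⊔_)
open import Algebra.Lattice.Bundles using (BooleanAlgebra)
import Algebra.Lattice.Properties.BooleanAlgebra as BooleanAlgebraProperties
open import Axiom.ExcludedMiddle using (ExcludedMiddle)
open import Axiom.DoubleNegationElimination using (em⇒dne)
open import Relation.Nullary using (¬_; yes; no)
open import Relation.Binary.Bundles using (Poset)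
open import Relation.Binary.PropositionalEquality using (subst) renaming (sym to ≡-sym)
open import Relation.Unary using (Pred)
open import Data.Nat using (ℕ; zero; suc; _+_; _∸_; _≤_; z≤n; s≤s)
open import Data.Nat.Properties
  using (≤-trans; n≤1+n; n<1+n; m≤m+n; m≤n+m; m+[n∸m]≡n; +-monoˡ-<; ≮⇒≥)
open import Data.Fin using (Fin)
open import Data.Product using (Σ; _×_; _,_; proj₁; proj₂)
open import Data.Sum using (_⊎_; inj₁; inj₂)
open import Data.Empty using (⊥-elim)
open import Function using (_∘_)

module _ {c ℓ : Level} (B : BooleanAlgebra c ℓ) where
  open BooleanAlgebra B hiding (¬_)
  open BooleanAlgebraProperties B using (poset; ∧-idem; ∧-zeroʳ; ∨-identityˡ; ∨-identityʳ)

  infix 4 _⊑_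
  _⊑_ : Carrier → Carrier → Set ℓ
  _⊑_ = _≤B_ B

  -- _⊑_ is the natural order of ∧ (with the two sides of ≈ swapped), so it
  -- inherits reflexivity and transitivity from the semilattice poset.
  ⊑-refl : ∀ x → x ⊑ x
  ⊑-refl = ∧-idem

  ⊑-trans : ∀ {x y z} → x ⊑ y → y ⊑ z → x ⊑ z
  ⊑-trans x⊑y y⊑z = sym (Poset.trans poset (sym x⊑y) (sym y⊑z))

  ≈⇒⊑ : ∀ {x y} → x ≈ y → x ⊑ y
  ≈⇒⊑ {x} x≈y = trans (∧-congˡ (sym x≈y)) (∧-idem x)

  Pos-mono : ∀ {x y} → x ⊑ y → Pos B x → Pos B y
  Pos-mono {x} x⊑y x>0 y≈0 =
    x>0 (trans (sym x⊑y) (trans (∧-congˡ y≈0) (∧-zeroʳ x)))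

  module FromMIdeal (lem : ∀ {a} → ExcludedMiddle a)
                    {i : Level} (I : Pred (Seq B) i) (isM : IsMIdeal B I) where
    open IsMIdeal isM

    dne : ∀ {a} {P : Set a} → ¬ ¬ P → P
    dne = em⇒dne lem

    Small : ℕ → Carrier → Set (c ⊔ ℓ ⊔ i)
    Small k x = Pos B x × Σ (Seq B) λ s → I s × x ⊑ s k

    Large : ℕ → Carrier → Set (c ⊔ ℓ ⊔ i)
    Large k x = Pos B x × ¬ Small k x

    member-small : ∀ {s} → I s → ∀ k → Small k (s k)
    member-small s∈I k = M0 s∈I k , _ , s∈I , ⊑-refl _

    -- Smallness passes to smaller indices: drop the first n ∸ m terms (M2).
    Small-antitone : ∀ {m n x} → m ≤ n → Small n x → Small m x
    Small-antitone {m} {n} {x} m≤n (x>0 , s , s∈I , x⊑sn) =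
      x>0 , (λ j → s (j + (n ∸ m))) ,
      M2 s∈I (λ j → j + (n ∸ m)) (λ j → +-monoˡ-< (n ∸ m) (n<1+n j)) ,
      subst (λ k → x ⊑ s k) (≡-sym (m+[n∸m]≡n m≤n)) x⊑sn

    Small-down : ∀ {k x y} → x ⊑ y → Pos B x → Small k y → Small k x
    Small-down x⊑y x>0 (_ , s , s∈I , y⊑sk) = x>0 , s , s∈I , ⊑-trans x⊑y y⊑sk

    Large-mono : ∀ {m n x} → m ≤ n → Large m x → Large n x
    Large-mono m≤n (x>0 , ¬small) = x>0 , ¬small ∘ Small-antitone m≤n

    Large-up : ∀ {k x y} → x ⊑ y → Large k x → Large k y
    Large-up x⊑y (x>0 , ¬small) = Pos-mono x⊑y x>0 , ¬small ∘ Small-down x⊑y x>0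

    -- A sequence whose k-th term is k-small for every k lies in I: it lies
    -- termwise below the diagonal of the witnessing sequences (M5, M3).
    diagonal : ∀ {x : Seq B} → (∀ k → Small k (x k)) → I x
    diagonal {x} small = M3 (M5 witness witness∈I) (proj₁ ∘ small) below-diagonal
      where
        witness : ℕ → Seq B
        witness k = proj₁ (proj₂ (small k))
        witness∈I : ∀ k → I (witness k)
        witness∈I k = proj₁ (proj₂ (proj₂ (small k)))
        below-diagonal : ∀ k → x k ⊑ witness k k
        below-diagonal k = proj₂ (proj₂ (proj₂ (small k)))

    -- Every positive element is k-large for some k: otherwise the constant
    -- sequence x is in I by `diagonal`, while x is a positive lower bound (M1).
    eventually-large : ∀ {x} → Pos B x → Σ ℕ λ k → Large k x
    eventually-large {x} x>0 = dne λ never →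
      M1 (diagonal {λ _ → x} (λ k → dne λ ¬small → never (k , x>0 , ¬small)))
         (x , x>0 , λ _ → ⊑-refl x)

    AntichainBound : ℕ → ℕ → Set (c ⊔ ℓ ⊔ i)
    AntichainBound k K = ∀ {m} (A : Fin m → Carrier) →
                         FinAntichain B A → (∀ j → Large k (A j)) → m ≤ K

    record LargeAntichain (k K : ℕ) : Set (c ⊔ ℓ ⊔ i) where
      field
        size      : ℕ
        elems     : Fin size → Carrier
        antichain : FinAntichain B elems
        large     : ∀ j → Large k (elems j)
        oversized : suc K ≤ size
    open LargeAntichain

    -- Arbitrarily large such antichains are impossible: M6 selects one
    -- element from each, giving a sequence in I whose k-th term is k-large.
    no-growing-antichains : ∀ k → ¬ (∀ K → LargeAntichain k K)
    no-growing-antichains k big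
      with M6 (size ∘ big) (elems ∘ big) (oversized ∘ big) (antichain ∘ big)
    ... | chosen , chosen∈I = proj₂ (large (big k) (chosen k)) (member-small chosen∈I k)

    antichainBound : ∀ k → Σ ℕ (AntichainBound k)
    antichainBound k = dne λ unbounded → no-growing-antichains k λ K → dne λ small-only →
      unbounded (K , λ {_} A A-antichain A-large → ≮⇒≥ λ K<m →
        small-only (record { elems = A ; antichain = A-antichain ; large = A-large ; oversized = K<m }))

    JoinBound : ℕ → ℕ → Set (c ⊔ ℓ ⊔ i)
    JoinBound q p = ∀ y z → Small p y → Small p z → Small q (y ∨ z)

    JoinBound-mono : ∀ {q p p′} → JoinBound q p → p ≤ p′ → JoinBound q p′
    JoinBound-mono bound p≤p′ y z y-small z-small =
      bound y z (Small-antitone p≤p′ y-small) (Small-antitone p≤p′ z-small)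

    record BadPair (q p : ℕ) : Set (c ⊔ ℓ ⊔ i) where
      field
        left right     : Carrier
        left-small     : Small p left
        right-small    : Small p right
        join-not-small : ¬ Small q (left ∨ right)
    open BadPair

    -- Bad pairs cannot exist at every p: both sides lie in I by `diagonal`,
    -- M4 puts a subsequence of their joins in I, and its q-th term is q-small.
    no-bad-sequence : ∀ q → ¬ (∀ p → BadPair q p)
    no-bad-sequence q bad
      with M4 (diagonal (left-small ∘ bad)) (diagonal (right-small ∘ bad))
    ... | σ , _ , joins∈I = join-not-small (bad (σ q)) (member-small joins∈I q)

    joinBound : ∀ q → Σ ℕ (JoinBound q)
    joinBound q = dne λ none → no-bad-sequence q λ p → dne λ no-bad →
      none (p , λ y z y-small z-small → dne λ ¬join-small →
        no-bad (record { left-small = y-small ; right-small = z-small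
                       ; join-not-small = ¬join-small }))

    zero-or-small : ∀ {p x} → ¬ Large p x → x ≈ ⊥ ⊎ Small p x
    zero-or-small {x = x} ¬large with lem {P = x ≈ ⊥}
    ... | yes x≈0 = inj₁ x≈0
    ... | no x>0 = inj₂ (dne λ ¬small → ¬large (x>0 , ¬small))

    large-join : ∀ {q p a b} → JoinBound q p → q ≤ p →
                 Large q (a ∨ b) → Large p a ⊎ Large p b
    large-join {q} {p} {a} {b} bound q≤p (a∨b>0 , ¬small) = dne λ neither →
      ¬small (join-small (zero-or-small (neither ∘ inj₁)) (zero-or-small (neither ∘ inj₂)))
      where
        join-small : a ≈ ⊥ ⊎ Small p a → b ≈ ⊥ ⊎ Small p b → Small q (a ∨ b)
        join-small (inj₁ a≈0) (inj₁ b≈0) =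
          ⊥-elim (a∨b>0 (trans (∨-congʳ a≈0) (trans (∨-identityˡ b) b≈0)))
        join-small (inj₁ a≈0) (inj₂ b-small) =
          Small-down (≈⇒⊑ (trans (∨-congʳ a≈0) (∨-identityˡ b))) a∨b>0
                     (Small-antitone q≤p b-small)
        join-small (inj₂ a-small) (inj₁ b≈0) =
          Small-down (≈⇒⊑ (trans (∨-congˡ b≈0) (∨-identityʳ a))) a∨b>0
                     (Small-antitone q≤p a-small)
        join-small (inj₂ a-small) (inj₂ b-small) = bound a b a-small b-small

    level : ℕ → ℕ
    level zero    = zero
    level (suc n) = suc (level n) + proj₁ (joinBound (level n))

    level-increasing : ∀ n → level n ≤ level (suc n)
    level-increasing n = ≤-trans (n≤1+n (level n)) (m≤m+n (suc (level n)) _)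

    level-joins : ∀ n → JoinBound (level n) (level (suc n))
    level-joins n = JoinBound-mono (proj₂ (joinBound (level n)))
                                   (m≤n+m _ (suc (level n)))

    level-unbounded : ∀ n → n ≤ level n
    level-unbounded zero    = z≤n
    level-unbounded (suc n) = ≤-trans (s≤s (level-unbounded n)) (m≤m+n (suc (level n)) _)

    C : ℕ → Pred Carrier (c ⊔ ℓ ⊔ i)
    C n = Large (level n)

    C-covers : ∀ {x} → Pos B x → Σ ℕ λ n → C n x
    C-covers x>0 with eventually-large x>0
    ... | k , k-large = k , Large-mono (level-unbounded k) k-large

corollary3p6 : (lem : ∀ {a} → ExcludedMiddle a) →
               {c ℓ i : Level} (B : BooleanAlgebra c ℓ) →
               ¬ (BooleanAlgebra._≈_ B (BooleanAlgebra.⊤ B) (BooleanAlgebra.⊥ B)) →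
               HasMIdeal B i →
               HasGradedσBoundedCCFragmentation B (c ⊔ ℓ ⊔ i)
corollary3p6 lem B _ (I , isM) =
  C ,
  record { increasing = λ n → Large-mono (level-increasing n)
         ; union⊆     = λ n → proj₁
         ; ⊆union     = C-covers
         ; upward     = λ n a∈C a⊑b → Large-up a⊑b a∈C } ,
  ((λ n → proj₁ (antichainBound (level n))) , λ n → proj₂ (antichainBound (level n))) ,
  (λ n a b → large-join (level-joins n) (level-increasing n))
  where open FromMIdeal B lem I isM
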